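{- For every $\sigma\in S_n(3\textrm{ - }1\textrm{ - }2)$, the permutations $\sigma$ and $\hat{\Delta}(\sigma)$ have the same number of occurrences of the consecutive pattern $213$.
   Context: $S_n(3\textrm{ - }1\textrm{ - }2)$ is the set of $\sigma\in S_n$ with no indices $i<j<l$ such that $\sigma(j)<\sigma(l)<\sigma(i)$. An occurrence of the consecutive pattern $213$ in $\sigma$ is an index $i$ with $\sigma(i+1)<\sigma(i)<\sigma(i+2)$. Dyck paths of semilength $n$ are words over $\{U,D\}$ with $n$ of each letter such that every prefix has at least as many $U$'s as $D$'s. Krattenthaler's map $K$: write $\sigma\in S_n(3\textrm{ - }1\textrm{ - }2)$ as $\sigma=m_1w_1m_2w_2\cdots m_kw_k$, where $m_1<\dots<m_k$ are the left-to-right maxima of $\sigma$ and $w_i$ is the (possibly empty) word of entries between $m_i$ and $m_{i+1}$ (after $m_k$ for $i=k$); then $K(\sigma)=U^{m_1}D^{|w_1|+1}U^{m_2-m_1}D^{|w_2|+1}\cdots U^{m_k-m_{k-1}}D^{|w_k|+1}$, a bijection onto Dyck paths of semilength $n$. Deutsch's involution $\Delta$: $\Delta$(empty) = empty; if $P=U\,A\,D\,B$ is the first-return decomposition ($A,B$ possibly empty Dyck paths), $\Delta(P)=U\,\Delta(B)\,D\,\Delta(A)$. $\hat{\Delta}=K^{ -1}\circ\Delta\circ K$. -}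

module Defs where

open import Data.Nat using (ℕ; zero; suc; _+_; _∸_; _<_; _<ᵇ_)
open import Data.Bool using (Bool; true; false; if_then_else_; _∧_)
open import Data.List using (List; []; _∷_; _++_; map; upTo; length; lookup; replicate; reverse)
open import Data.Product using (_×_; _,_)
open import Data.Fin using (Fin)
import Data.Fin as F
open import Data.List.Relation.Binary.Permutation.Propositional using (_↭_)
open import Relation.Nullary using (¬_)

IsPerm : ℕ → List ℕ → Set
IsPerm n σ = σ ↭ map suc (upTo n)

Avoids312 : List ℕ → Set
Avoids312 σ = (i j l : Fin (length σ)) → i F.< j → j F.< l →
  ¬ (lookup σ j < lookup σ l × lookup σ l < lookup σ i)

InS312 : ℕ → List ℕ → Set
InS312 n σ = IsPerm n σ × Avoids312 σ

occ213 : List ℕ → ℕ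
occ213 (a ∷ b ∷ c ∷ xs) =
  (if (b <ᵇ a) ∧ (a <ᵇ c) then 1 else 0) + occ213 (b ∷ c ∷ xs)
occ213 _ = 0

data Step : Set where
  U D : Step

-- Decomposition σ = m₁ w₁ m₂ w₂ ⋯ m_k w_k by left-to-right maxima:
-- list of the pairs (m_i , w_i).
ltrGo : ℕ → List ℕ → List ℕ → List (ℕ × List ℕ)
ltrGo m w [] = (m , reverse w) ∷ []
ltrGo m w (x ∷ xs) =
  if m <ᵇ x then (m , reverse w) ∷ ltrGo x [] xs else ltrGo m (x ∷ w) xs

ltrBlocks : List ℕ → List (ℕ × List ℕ)
ltrBlocks [] = []
ltrBlocks (x ∷ xs) = ltrGo x [] xs

-- K(σ) = U^{m₁} D^{|w₁|+1} U^{m₂-m₁} D^{|w₂|+1} ⋯ (with m₀ = 0)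
Kblocks : ℕ → List (ℕ × List ℕ) → List Step
Kblocks prev [] = []
Kblocks prev ((m , w) ∷ bs) =
  replicate (m ∸ prev) U ++ replicate (suc (length w)) D ++ Kblocks m bs

K : List ℕ → List Step
K σ = Kblocks 0 (ltrBlocks σ)

-- First-return decomposition: given the word following an initial U
-- (at relative height h), return (A , B) with word = A D B, A balanced.
firstReturn : ℕ → List Step → List Step × List Step
firstReturn h [] = ([] , [])
firstReturn zero (D ∷ xs) = ([] , xs)
firstReturn (suc h) (D ∷ xs) with firstReturn h xs
... | (a , b) = (D ∷ a , b)
firstReturn h (U ∷ xs) with firstReturn (suc h) xs
... | (a , b) = (U ∷ a , b)

-- Deutsch's involution, with fuel (length of the path suffices).
-- Δ(empty) = empty;  Δ(U A D B) = U Δ(B) D Δ(A).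
-- (Non-Dyck inputs are irrelevant; they are sent to [].)
Δfuel : ℕ → List Step → List Step
Δfuel zero _ = []
Δfuel (suc f) [] = []
Δfuel (suc f) (D ∷ _) = []
Δfuel (suc f) (U ∷ xs) with firstReturn 0 xs
... | (a , b) = U ∷ Δfuel f b ++ D ∷ Δfuel f a

Δ : List Step → List Step
Δ P = Δfuel (length P) P

-- Under K every entry of σ ends with a D, and each new left-to-right maximum is
-- preceded by a run of U's.  In a 312-avoiding permutation an occurrence
-- σ(i+1) < σ(i) < σ(i+2) of 213 happens exactly when σ(i+2) is a new maximum
-- and σ(i+1) is not (an ascent lying below an earlier entry would complete a
-- 312), i.e. when a run of at least two D's is followed by U.  So occurrences
-- of 213 in σ are the factors DDU of K σ.  Deutsch's involution preserves their
-- number: for P = U A D B the factors DDU of P are those of A, those of B, and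
-- one more exactly when A and B are both nonempty, a count symmetric in A and B.
module Submission where

open import Defs
open import Data.Nat using (ℕ; zero; suc; _+_; _*_; _∸_; _⊓_; _<_; _≤_; _<ᵇ_; z≤n; s≤s; z<s; s<s; _<?_)
open import Data.Nat.Properties
open import Data.Bool using (true; false; if_then_else_; _∧_)
open import Data.Unit using (⊤)
open import Data.Empty using (⊥-elim)
open import Data.Fin as F using ()
open import Data.List using (List; []; _∷_; _++_; map; upTo; length; lookup; replicate)
open import Data.List.Properties using (length-map; length-upTo; length-reverse; length-++; ++-identityʳ)
open import Data.Product using (_×_; _,_; proj₁; proj₂)
open import Relation.Nullary using (¬_; yes; no)
open import Relation.Binary.PropositionalEquality
open import Data.List.Relation.Unary.All as All using (All; []; _∷_)
open import Data.List.Relation.Unary.All.Properties using (++⁻ˡ)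
open import Data.List.Relation.Unary.Any using (here; there)
open import Data.List.Relation.Unary.Unique.Propositional using (Unique; []; _∷_)
open import Data.List.Relation.Unary.Unique.Propositional.Properties using (map⁺; upTo⁺; Unique[x∷xs]⇒x∉xs)
open import Data.List.Membership.Propositional using (_∈_; _∉_)
open import Data.List.Membership.Propositional.Properties
  using (∈-∃++; ∈-++⁺ˡ; ∈-++⁺ʳ; ∈-map⁺; ∈-map⁻; ∈-upTo⁺; ∈-upTo⁻)
open import Data.List.Relation.Binary.Subset.Propositional using (_⊆_)
open import Data.List.Relation.Binary.Permutation.Propositional using (↭-sym; ↭-trans; ↭⇒↭ₛ)
open import Data.List.Relation.Binary.Permutation.Propositional.Properties using (∈-resp-↭; ↭-length; shift)
open import Data.List.Relation.Binary.Permutation.Setoid.Properties using (Unique-resp-↭)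

open ≡-Reasoning

data Dyck : ℕ → List Step → Set where
  done : Dyck 0 []
  up   : ∀ {h P} → Dyck (suc h) P → Dyck h (U ∷ P)
  down : ∀ {h P} → Dyck h P → Dyck (suc h) (D ∷ P)

Dyck-++ : ∀ {h k A B} → Dyck h A → Dyck k B → Dyck (h + k) (A ++ B)
Dyck-++ done      dB = dB
Dyck-++ (up dA)   dB = up (Dyck-++ dA dB)
Dyck-++ (down dA) dB = down (Dyck-++ dA dB)

Dyck-replicateD : ∀ k → Dyck k (replicate k D)
Dyck-replicateD zero    = done
Dyck-replicateD (suc k) = down (Dyck-replicateD k)

Dyck-replicateU : ∀ a {h Q} → Dyck (a + h) Q → Dyck h (replicate a U ++ Q)
Dyck-replicateU zero            dQ = dQ
Dyck-replicateU (suc a) {h} {Q} dQ =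
  up (Dyck-replicateU a (subst (λ k → Dyck k Q) (sym (+-suc a h)) dQ))

firstReturn-Dyck : ∀ h {s} xs → Dyck (suc (h + s)) xs →
  let (A , B) = firstReturn h xs in xs ≡ A ++ D ∷ B × Dyck h A × Dyck s B
firstReturn-Dyck zero    (D ∷ xs) (down d) = refl , done , d
firstReturn-Dyck (suc h) (D ∷ xs) (down d) =
  let (xs≡ , dA , dB) = firstReturn-Dyck h xs d in cong (D ∷_) xs≡ , down dA , dB
firstReturn-Dyck zero    (U ∷ xs) (up d) =
  let (xs≡ , dA , dB) = firstReturn-Dyck 1 xs d in cong (U ∷_) xs≡ , up dA , dB
firstReturn-Dyck (suc h) (U ∷ xs) (up d) =
  let (xs≡ , dA , dB) = firstReturn-Dyck (suc (suc h)) xs d in cong (U ∷_) xs≡ , up dA , dB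

Δfuel-[] : ∀ f → Δfuel f [] ≡ []
Δfuel-[] zero    = refl
Δfuel-[] (suc f) = refl

Dyck-Δfuel : ∀ f {P} → Dyck 0 P → Dyck 0 (Δfuel f P)
Dyck-Δfuel zero    _               = done
Dyck-Δfuel (suc f) done            = done
Dyck-Δfuel (suc f) (up {P = xs} d) =
  let (_ , dA , dB) = firstReturn-Dyck 0 xs d
  in up (Dyck-++ (Dyck-Δfuel f dB) (down (Dyck-Δfuel f dA)))

1⊓length-Δfuel : ∀ f {P} → Dyck 0 P → length P ≤ f → 1 ⊓ length (Δfuel f P) ≡ 1 ⊓ length P
1⊓length-Δfuel f       done   _ = cong (λ P → 1 ⊓ length P) (Δfuel-[] f)
1⊓length-Δfuel (suc f) (up _) _ = refl

startsWithU : List Step → ℕ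
startsWithU (U ∷ _) = 1
startsWithU _       = 0

endsWithD : List Step → ℕ
endsWithD []          = 0
endsWithD (U ∷ [])    = 0
endsWithD (D ∷ [])    = 1
endsWithD (_ ∷ y ∷ P) = endsWithD (y ∷ P)

startsWithDU : List Step → ℕ
startsWithDU (D ∷ U ∷ _) = 1
startsWithDU _           = 0

countDDU : List Step → ℕ
countDDU []      = 0
countDDU (U ∷ P) = countDDU P
countDDU (D ∷ P) = startsWithDU P + countDDU P

startsWithDU-++-D∷ : ∀ y A B → startsWithDU (y ∷ A ++ D ∷ B) ≡ startsWithDU (y ∷ A)
startsWithDU-++-D∷ U _       _ = refl
startsWithDU-++-D∷ D []      _ = refl
startsWithDU-++-D∷ D (U ∷ _) _ = refl
startsWithDU-++-D∷ D (D ∷ _) _ = refl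

countDDU-++-D∷ : ∀ A B →
  countDDU (A ++ D ∷ B) ≡ countDDU A + (countDDU (D ∷ B) + endsWithD A * startsWithU B)
countDDU-++-D∷ []          _       = sym (+-identityʳ _)
countDDU-++-D∷ (U ∷ [])    _       = sym (+-identityʳ _)
countDDU-++-D∷ (D ∷ [])    []      = refl
countDDU-++-D∷ (D ∷ [])    (U ∷ B) = +-comm 1 (countDDU B)
countDDU-++-D∷ (D ∷ [])    (D ∷ B) = sym (+-identityʳ _)
countDDU-++-D∷ (U ∷ y ∷ A) B       = countDDU-++-D∷ (y ∷ A) B
countDDU-++-D∷ (D ∷ y ∷ A) B       =
  trans (cong₂ _+_ (startsWithDU-++-D∷ y A B) (countDDU-++-D∷ (y ∷ A) B))
        (sym (+-assoc (startsWithDU (y ∷ A)) (countDDU (y ∷ A)) _))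

Dyck-endsWithD : ∀ {h A} → Dyck h A → endsWithD A ≡ 1 ⊓ length A
Dyck-endsWithD done                 = refl
Dyck-endsWithD (up {P = _ ∷ _} d)   = Dyck-endsWithD d
Dyck-endsWithD (down {P = []} _)    = refl
Dyck-endsWithD (down {P = _ ∷ _} d) = Dyck-endsWithD d

Dyck₀-startsWithU : ∀ {B} → Dyck 0 B → startsWithU B ≡ 1 ⊓ length B
Dyck₀-startsWithU done   = refl
Dyck₀-startsWithU (up _) = refl

Dyck₀-countDDU-D∷ : ∀ {B} → Dyck 0 B → countDDU (D ∷ B) ≡ countDDU B
Dyck₀-countDDU-D∷ done   = refl
Dyck₀-countDDU-D∷ (up _) = refl

countDDU-++-D∷-Dyck : ∀ {A B} → Dyck 0 A → Dyck 0 B →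
  countDDU (A ++ D ∷ B) ≡ countDDU A + countDDU B + (1 ⊓ length A) * (1 ⊓ length B)
countDDU-++-D∷-Dyck {A} {B} dA dB = begin
  countDDU (A ++ D ∷ B)
    ≡⟨ countDDU-++-D∷ A B ⟩
  countDDU A + (countDDU (D ∷ B) + endsWithD A * startsWithU B)
    ≡⟨ cong (countDDU A +_) (cong₂ _+_ (Dyck₀-countDDU-D∷ dB)
                                       (cong₂ _*_ (Dyck-endsWithD dA) (Dyck₀-startsWithU dB))) ⟩
  countDDU A + (countDDU B + (1 ⊓ length A) * (1 ⊓ length B))
    ≡⟨ +-assoc (countDDU A) (countDDU B) _ ⟨
  countDDU A + countDDU B + (1 ⊓ length A) * (1 ⊓ length B) ∎

countDDU-Δfuel : ∀ f {P} → Dyck 0 P → length P ≤ f → countDDU (Δfuel f P) ≡ countDDU P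
countDDU-Δfuel f done _ = cong countDDU (Δfuel-[] f)
countDDU-Δfuel (suc f) (up {P = xs} d) (s≤s |xs|≤f) = begin
  countDDU (Δfuel f B ++ D ∷ Δfuel f A)
    ≡⟨ countDDU-++-D∷-Dyck (Dyck-Δfuel f dB) (Dyck-Δfuel f dA) ⟩
  countDDU (Δfuel f B) + countDDU (Δfuel f A)
    + (1 ⊓ length (Δfuel f B)) * (1 ⊓ length (Δfuel f A))
    ≡⟨ cong₂ _+_ (cong₂ _+_ (countDDU-Δfuel f dB |B|≤f) (countDDU-Δfuel f dA |A|≤f))
                 (cong₂ _*_ (1⊓length-Δfuel f dB |B|≤f) (1⊓length-Δfuel f dA |A|≤f)) ⟩
  countDDU B + countDDU A + (1 ⊓ length B) * (1 ⊓ length A)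
    ≡⟨ cong₂ _+_ (+-comm (countDDU B) _) (*-comm (1 ⊓ length B) _) ⟩
  countDDU A + countDDU B + (1 ⊓ length A) * (1 ⊓ length B)
    ≡⟨ countDDU-++-D∷-Dyck dA dB ⟨
  countDDU (A ++ D ∷ B)
    ≡⟨ cong countDDU xs≡ ⟨
  countDDU xs ∎
  where
  A = proj₁ (firstReturn 0 xs)
  B = proj₂ (firstReturn 0 xs)
  decomposition = firstReturn-Dyck 0 xs d
  xs≡ = proj₁ decomposition
  dA = proj₁ (proj₂ decomposition)
  dB = proj₂ (proj₂ decomposition)
  |xs|≡ : length xs ≡ length A + suc (length B)
  |xs|≡ = trans (cong length xs≡) (length-++ A)
  |A|≤f : length A ≤ f
  |A|≤f = ≤-trans (m≤m+n (length A) _) (subst (_≤ f) |xs|≡ |xs|≤f)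
  |B|≤f : length B ≤ f
  |B|≤f = ≤-trans (≤-trans (n≤1+n _) (m≤n+m _ (length A))) (subst (_≤ f) |xs|≡ |xs|≤f)

countDDU-Δ : ∀ {P} → Dyck 0 P → countDDU (Δ P) ≡ countDDU P
countDDU-Δ d = countDDU-Δfuel _ d ≤-refl

<ᵇ-true : ∀ {m n} → m < n → (m <ᵇ n) ≡ true
<ᵇ-true {zero}  (s≤s _)   = refl
<ᵇ-true {suc _} (s≤s m<n) = <ᵇ-true m<n

<ᵇ-false : ∀ {m n} → n ≤ m → (m <ᵇ n) ≡ false
<ᵇ-false z≤n       = refl
<ᵇ-false (s≤s n≤m) = <ᵇ-false n≤m

-- The part of K σ following the run of U's up to the current maximum m,
-- when k entries have been read since m and ys is still to be read.
Ktail : ℕ → ℕ → List ℕ → List Step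
Ktail m k []       = replicate (suc k) D
Ktail m k (y ∷ ys) =
  if m <ᵇ y then replicate (suc k) D ++ replicate (y ∸ m) U ++ Ktail y 0 ys
            else Ktail m (suc k) ys

Kblocks-ltrGo : ∀ p m w xs →
  Kblocks p (ltrGo m w xs) ≡ replicate (m ∸ p) U ++ Ktail m (length w) xs
Kblocks-ltrGo p m w [] =
  cong (replicate (m ∸ p) U ++_)
       (trans (++-identityʳ _) (cong (λ l → replicate (suc l) D) (length-reverse w)))
Kblocks-ltrGo p m w (x ∷ xs) with m <ᵇ x
... | true  = cong₂ (λ l t → replicate (m ∸ p) U ++ replicate (suc l) D ++ t)
                    (length-reverse w) (Kblocks-ltrGo m x [] xs)
... | false = Kblocks-ltrGo p m (x ∷ w) xs

K-∷ : ∀ x xs → K (x ∷ xs) ≡ replicate x U ++ Ktail x 0 xs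
K-∷ x xs = Kblocks-ltrGo 0 x [] xs

Ktail-record : ∀ {m k y} ys → m < y →
  Ktail m k (y ∷ ys) ≡ replicate (suc k) D ++ replicate (y ∸ m) U ++ Ktail y 0 ys
Ktail-record _ m<y rewrite <ᵇ-true m<y = refl

Ktail-nonrecord : ∀ {m k y} ys → y ≤ m → Ktail m k (y ∷ ys) ≡ Ktail m (suc k) ys
Ktail-nonrecord _ y≤m rewrite <ᵇ-false y≤m = refl

countDDU-replicateU : ∀ a R → countDDU (replicate a U ++ R) ≡ countDDU R
countDDU-replicateU zero    R = refl
countDDU-replicateU (suc a) R = countDDU-replicateU a R

countDDU-replicateD : ∀ k → countDDU (replicate k D) ≡ 0
countDDU-replicateD 0                   = refl
countDDU-replicateD 1                   = refl
countDDU-replicateD 2                   = refl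
countDDU-replicateD (suc (suc (suc k))) = countDDU-replicateD (suc (suc k))

countDDU-replicateD-replicateU : ∀ k {a} R → 0 < a →
  countDDU (replicate (suc k) D ++ replicate a U ++ R) ≡ 1 ⊓ k + countDDU R
countDDU-replicateD-replicateU 0             {suc a} R _   = countDDU-replicateU a R
countDDU-replicateD-replicateU 1             {suc a} R _   = cong suc (countDDU-replicateU a R)
countDDU-replicateD-replicateU (suc (suc k))         R 0<a =
  countDDU-replicateD-replicateU (suc k) R 0<a

countDDU-Ktail-record : ∀ {m k y} ys → m < y →
  countDDU (Ktail m k (y ∷ ys)) ≡ 1 ⊓ k + countDDU (Ktail y 0 ys)
countDDU-Ktail-record {k = k} ys m<y =
  trans (cong countDDU (Ktail-record ys m<y))
        (countDDU-replicateD-replicateU k _ (m<n⇒0<n∸m m<y))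

[1‥_] : ℕ → List ℕ
[1‥ n ] = map suc (upTo n)

∈-[1‥]⁺ : ∀ {n x} → 0 < x → x ≤ n → x ∈ [1‥ n ]
∈-[1‥]⁺ {x = suc x} _ x<n = ∈-map⁺ suc (∈-upTo⁺ x<n)

∈-[1‥]⁻ : ∀ {n x} → x ∈ [1‥ n ] → 0 < x × x ≤ n
∈-[1‥]⁻ x∈ with ∈-map⁻ suc x∈
... | _ , i∈ , refl = z<s , ∈-upTo⁻ i∈

length-[1‥] : ∀ n → length [1‥ n ] ≡ n
length-[1‥] n = trans (length-map suc (upTo n)) (length-upTo n)

Unique-++⁻ˡ : ∀ {a} {A : Set a} (xs : List A) {ys} → Unique (xs ++ ys) → Unique xs
Unique-++⁻ˡ []       _             = []
Unique-++⁻ˡ (x ∷ xs) (x∉ ∷ unique) = ++⁻ˡ xs x∉ ∷ Unique-++⁻ˡ xs unique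

Unique-⊆⇒length≤ : ∀ {a} {A : Set a} {xs ys : List A} → Unique xs → xs ⊆ ys → length xs ≤ length ys
Unique-⊆⇒length≤ {xs = []}     _               _     = z≤n
Unique-⊆⇒length≤ {xs = x ∷ xs} (x∉xs ∷ unique) xs⊆ys with ∈-∃++ (xs⊆ys (here refl))
... | us , vs , refl = subst (suc (length xs) ≤_) (sym (↭-length (shift x us vs)))
                             (s≤s (Unique-⊆⇒length≤ unique xs⊆us++vs))
  where
  xs⊆us++vs : xs ⊆ us ++ vs
  xs⊆us++vs z∈xs with ∈-resp-↭ (shift x us vs) (xs⊆ys (there z∈xs))
  ... | here z≡x = ⊥-elim (All.lookup x∉xs z∈xs (sym z≡x))
  ... | there z∈ = z∈

IsPerm-Unique : ∀ {n σ} → IsPerm n σ → Unique σ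
IsPerm-Unique {n} perm =
  Unique-resp-↭ (setoid ℕ) (↭⇒↭ₛ (↭-sym perm)) (map⁺ suc-injective (upTo⁺ n))

IsPerm-length : ∀ {n σ} → IsPerm n σ → length σ ≡ n
IsPerm-length {n} perm = trans (↭-length perm) (length-[1‥] n)

IsPerm-entry : ∀ {n σ x} → IsPerm n σ → x ∈ σ → 0 < x × x ≤ n
IsPerm-entry perm x∈σ = ∈-[1‥]⁻ (∈-resp-↭ perm x∈σ)

IsPerm-prefix-length≤ : ∀ {n m} q {s} → IsPerm n (q ++ s) → All (_≤ m) q → length q ≤ m
IsPerm-prefix-length≤ {m = m} q perm q≤m =
  subst (length q ≤_) (length-[1‥] m) (Unique-⊆⇒length≤ (Unique-++⁻ˡ q (IsPerm-Unique perm)) q⊆)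
  where
  q⊆ : q ⊆ [1‥ m ]
  q⊆ z∈q = ∈-[1‥]⁺ (proj₁ (IsPerm-entry perm (∈-++⁺ˡ z∈q))) (All.lookup q≤m z∈q)

∸-suc : ∀ {l m} → suc l ≤ m → suc (m ∸ suc l) ≡ m ∸ l
∸-suc {l} sl≤m = sym (+-∸-assoc 1 sl≤m)

∸-split : ∀ {l m y} → l ≤ m → m ≤ y → (y ∸ m) + (m ∸ l) ≡ y ∸ l
∸-split {l} {m} {y} l≤m m≤y =
  trans (sym (+-∸-assoc (y ∸ m) l≤m)) (cong (_∸ l) (m∸n+n≡m m≤y))

-- pre holds the entries already read, most recent first, and m is their maximum.
Dyck-Ktail : ∀ {n m} k pre ys → IsPerm n (pre ++ ys) → All (_≤ m) pre → m ≤ n →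
  Dyck ((m ∸ length pre) + suc k) (Ktail m k ys)
Dyck-Ktail {n} {m} k pre [] perm _ m≤n =
  subst (λ h → Dyck (h + suc k) (replicate (suc k) D))
        (sym (m≤n⇒m∸n≡0 (subst (m ≤_) (sym |pre|≡n) m≤n))) (Dyck-replicateD (suc k))
  where
  |pre|≡n : length pre ≡ n
  |pre|≡n = IsPerm-length (subst (IsPerm n) (++-identityʳ pre) perm)
Dyck-Ktail {n} {m} k pre (y ∷ ys) perm pre≤m m≤n with m <? y
... | yes m<y =
  subst (Dyck _) (sym (Ktail-record ys m<y))
    (subst (λ h → Dyck h (replicate (suc k) D ++ rest)) (+-comm (suc k) (m ∸ length pre))
      (Dyck-++ (Dyck-replicateD (suc k)) dRest))
  where
  y∈ = ∈-++⁺ʳ pre (here refl)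
  perm′ = ↭-trans (↭-sym (shift y pre ys)) perm
  y∷pre≤y : All (_≤ y) (y ∷ pre)
  y∷pre≤y = ≤-refl ∷ All.map (λ z≤m → ≤-trans z≤m (<⇒≤ m<y)) pre≤m
  heights : (y ∸ suc (length pre)) + 1 ≡ (y ∸ m) + (m ∸ length pre)
  heights = begin
    (y ∸ suc (length pre)) + 1 ≡⟨ +-comm _ 1 ⟩
    suc (y ∸ suc (length pre)) ≡⟨ ∸-suc (IsPerm-prefix-length≤ (y ∷ pre) perm′ y∷pre≤y) ⟩
    y ∸ length pre             ≡⟨ ∸-split (IsPerm-prefix-length≤ pre perm pre≤m) (<⇒≤ m<y) ⟨
    (y ∸ m) + (m ∸ length pre) ∎
  rest = replicate (y ∸ m) U ++ Ktail y 0 ys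
  dRest : Dyck (m ∸ length pre) rest
  dRest = Dyck-replicateU (y ∸ m) (subst (λ h → Dyck h (Ktail y 0 ys)) heights
            (Dyck-Ktail 0 (y ∷ pre) ys perm′ y∷pre≤y (proj₂ (IsPerm-entry perm y∈))))
... | no m≮y =
  subst (Dyck _) (sym (Ktail-nonrecord ys y≤m))
    (subst (λ h → Dyck h (Ktail m (suc k) ys)) heights
      (Dyck-Ktail (suc k) (y ∷ pre) ys perm′ y∷pre≤m m≤n))
  where
  y≤m = ≮⇒≥ m≮y
  perm′ = ↭-trans (↭-sym (shift y pre ys)) perm
  y∷pre≤m : All (_≤ m) (y ∷ pre)
  y∷pre≤m = y≤m ∷ pre≤m
  heights : (m ∸ suc (length pre)) + suc (suc k) ≡ (m ∸ length pre) + suc k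
  heights = trans (+-suc _ (suc k))
                  (cong (_+ suc k) (∸-suc (IsPerm-prefix-length≤ (y ∷ pre) perm′ y∷pre≤m)))

Dyck-K : ∀ {n σ} → IsPerm n σ → Dyck 0 (K σ)
Dyck-K {σ = []}     _    = done
Dyck-K {σ = x ∷ xs} perm =
  subst (Dyck 0) (sym (K-∷ x xs))
    (Dyck-replicateU x (subst (λ h → Dyck h (Ktail x 0 xs)) (trans (m∸n+n≡m 0<x) (sym (+-identityʳ x)))
      (Dyck-Ktail 0 (x ∷ []) xs perm (≤-refl ∷ []) x≤n)))
  where
  0<x = proj₁ (IsPerm-entry perm (here refl))
  x≤n = proj₂ (IsPerm-entry perm (here refl))

NoAscentBelow : ℕ → List ℕ → Set
NoAscentBelow z (a ∷ b ∷ r) = ¬ (a < b × b < z) × NoAscentBelow z (b ∷ r)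
NoAscentBelow z _           = ⊤

Avoids3-12 : List ℕ → Set
Avoids3-12 []       = ⊤
Avoids3-12 (z ∷ zs) = NoAscentBelow z zs × Avoids3-12 zs

NoAscentBelow-∷ : ∀ {z} zs → NoAscentBelow z zs → NoAscentBelow z (z ∷ zs)
NoAscentBelow-∷ []      _ = _
NoAscentBelow-∷ (_ ∷ _) h = (λ (z<b , b<z) → <-asym z<b b<z) , h

noPairBelow⇒NoAscentBelow : ∀ {z} zs →
  (∀ j l → j F.< l → ¬ (lookup zs j < lookup zs l × lookup zs l < z)) → NoAscentBelow z zs
noPairBelow⇒NoAscentBelow []          _ = _
noPairBelow⇒NoAscentBelow (_ ∷ [])    _ = _
noPairBelow⇒NoAscentBelow (_ ∷ b ∷ r) h =
  h F.zero (F.suc F.zero) z<s ,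
  noPairBelow⇒NoAscentBelow (b ∷ r) (λ j l j<l → h (F.suc j) (F.suc l) (s<s j<l))

Avoids312⇒Avoids3-12 : ∀ σ → Avoids312 σ → Avoids3-12 σ
Avoids312⇒Avoids3-12 []       _        = _
Avoids312⇒Avoids3-12 (z ∷ zs) avoids312 =
  noPairBelow⇒NoAscentBelow zs (λ j l j<l → avoids312 F.zero (F.suc j) (F.suc l) z<s (s<s j<l)) ,
  Avoids312⇒Avoids3-12 zs (λ i j l i<j j<l → avoids312 (F.suc i) (F.suc j) (F.suc l) (s<s i<j) (s<s j<l))

is213 : ℕ → ℕ → ℕ → ℕ
is213 a b c = if (b <ᵇ a) ∧ (a <ᵇ c) then 1 else 0

-- For consecutive entries p, c read k entries after the current maximum:
-- c is that maximum (k = 0) and exceeds p, or c lies in its block below p.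
EntryOrder : ℕ → ℕ → ℕ → Set
EntryOrder zero    p c = p < c
EntryOrder (suc _) p c = c < p

is213-record : ∀ k {p c y} → EntryOrder k p c → p < y → is213 p c y ≡ 1 ⊓ k
is213-record zero    p<c _   rewrite <ᵇ-false (<⇒≤ p<c)          = refl
is213-record (suc _) c<p p<y rewrite <ᵇ-true c<p | <ᵇ-true p<y = refl

is213-nonrecord : ∀ k {p c y} → EntryOrder k p c → y < c → is213 p c y ≡ 0
is213-nonrecord zero    p<c _   rewrite <ᵇ-false (<⇒≤ p<c) = refl
is213-nonrecord (suc _) c<p y<c
  rewrite <ᵇ-true c<p | <ᵇ-false (<⇒≤ (<-trans y<c c<p)) = refl

occ213≡countDDU-Ktail : ∀ {m k p c} ys →
  Avoids3-12 (c ∷ ys) → NoAscentBelow m (c ∷ ys) → Unique (c ∷ ys) → m ∉ ys →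
  EntryOrder k p c → p ≤ m → c ≤ m → occ213 (p ∷ c ∷ ys) ≡ countDDU (Ktail m k ys)
occ213≡countDDU-Ktail {k = k} [] _ _ _ _ _ _ _ = sym (countDDU-replicateD (suc k))
occ213≡countDDU-Ktail {m} {k} {p} {c} (y ∷ ys)
  (_ , avoids) (c≮y<m , noAscent) ((c≢y ∷ _) ∷ unique) m∉ order p≤m c≤m with m <? y
... | yes m<y = begin
  is213 p c y + occ213 (c ∷ y ∷ ys)
    ≡⟨ cong₂ _+_ (is213-record k order (≤-<-trans p≤m m<y))
                 (occ213≡countDDU-Ktail ys avoids (NoAscentBelow-∷ ys (proj₁ avoids)) unique
                    (Unique[x∷xs]⇒x∉xs unique) (≤-<-trans c≤m m<y) (<⇒≤ (≤-<-trans c≤m m<y)) ≤-refl) ⟩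
  1 ⊓ k + countDDU (Ktail y 0 ys)
    ≡⟨ countDDU-Ktail-record ys m<y ⟨
  countDDU (Ktail m k (y ∷ ys)) ∎
... | no m≮y = begin
  is213 p c y + occ213 (c ∷ y ∷ ys)
    ≡⟨ cong₂ _+_ (is213-nonrecord k order y<c)
                 (occ213≡countDDU-Ktail ys avoids noAscent unique (λ m∈ys → m∉ (there m∈ys)) y<c c≤m y≤m) ⟩
  countDDU (Ktail m (suc k) ys)
    ≡⟨ cong countDDU (Ktail-nonrecord ys y≤m) ⟨
  countDDU (Ktail m k (y ∷ ys)) ∎
  where
  y≤m = ≮⇒≥ m≮y
  y<m : y < m
  y<m = ≤∧≢⇒< y≤m (λ y≡m → m∉ (here (sym y≡m)))
  y<c : y < c
  y<c = ≤∧≢⇒< (≮⇒≥ (λ c<y → c≮y<m (c<y , y<m))) (λ y≡c → c≢y (sym y≡c))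

-- Prepending 0 creates no occurrence of 213, and it lets the first entry of σ
-- be treated like any later left-to-right maximum.
occ213-0∷ : ∀ x xs → occ213 (0 ∷ x ∷ xs) ≡ occ213 (x ∷ xs)
occ213-0∷ x []      = refl
occ213-0∷ x (_ ∷ _) = refl

occ213≡countDDU-K : ∀ {n σ} → InS312 n σ → occ213 σ ≡ countDDU (K σ)
occ213≡countDDU-K {σ = []}     _                  = refl
occ213≡countDDU-K {σ = x ∷ xs} (perm , avoids312) = begin
  occ213 (x ∷ xs)
    ≡⟨ occ213-0∷ x xs ⟨
  occ213 (0 ∷ x ∷ xs)
    ≡⟨ occ213≡countDDU-Ktail xs avoids (NoAscentBelow-∷ xs (proj₁ avoids)) unique
         (Unique[x∷xs]⇒x∉xs unique) (proj₁ (IsPerm-entry perm (here refl))) z≤n ≤-refl ⟩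
  countDDU (Ktail x 0 xs)
    ≡⟨ countDDU-replicateU x _ ⟨
  countDDU (replicate x U ++ Ktail x 0 xs)
    ≡⟨ cong countDDU (K-∷ x xs) ⟨
  countDDU (K (x ∷ xs)) ∎
  where
  avoids = Avoids312⇒Avoids3-12 (x ∷ xs) avoids312
  unique = IsPerm-Unique perm

proposition14 : (n : ℕ) (σ τ : List ℕ) → InS312 n σ → InS312 n τ →
    K τ ≡ Δ (K σ) → occ213 σ ≡ occ213 τ
proposition14 n σ τ σ∈ τ∈ Kτ≡ΔKσ = begin
  occ213 σ           ≡⟨ occ213≡countDDU-K σ∈ ⟩
  countDDU (K σ)     ≡⟨ countDDU-Δ (Dyck-K (proj₁ σ∈)) ⟨
  countDDU (Δ (K σ)) ≡⟨ cong countDDU Kτ≡ΔKσ ⟨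
  countDDU (K τ)     ≡⟨ occ213≡countDDU-K τ∈ ⟨
  occ213 τ           ∎
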